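{- Let $G$ be a connected chordal graph, $K^\star$ a maximal clique of $G$, and consider the layer structure of $C(G)$ rooted by $K^\star$. For every edge $UU'$ of the layer structure, its label equals $\mathcal{V}(U)\cap\mathcal{V}(U')$.
   Context: Graphs are finite, simple, undirected; chordal means no induced cycle of length greater than three. A $u$-$v$ separator of $G$ is a set $X\subseteq V(G)$ with $u,v$ in different components of $G-X$; it is minimal if no proper subset is one. The clique graph $C(G)$ has as nodes the maximal cliques of $G$; distinct nodes $K,K'$ are adjacent iff $K\cap K'$ is a minimal $u$-$v$ separator of $G$ for all $u\in K\setminus K'$, $v\in K'\setminus K$; edge $KK'$ has label $K\cap K'$ and weight $|K\cap K'|$. Units are the connected components of $C(G)$ after deleting all edges of minimum weight. For a unit $U$, $\mathcal{K}(U)$ is its set of nodes (maximal cliques) and $\mathcal{V}(U)=\bigcup_{K\in\mathcal{K}(U)}K$. An edge of $C(G)$ crosses units $U,U'$ if its endpoints lie one in each. The layer structure of $C(G)$ rooted by $K^\star$ is the graph whose vertices are the units, with $U,U'$ adjacent iff some edge of $C(G)$ crosses them; the label of edge $UU'$ is $K\cap K'$ for any edge $KK'$ of $C(G)$ crossing $U,U'$ (all such edges have the same label). The root is the unit containing $K^\star$. -}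

module Defs where

open import Data.Nat using (ℕ; suc; _+_; _<_; _≤_)
open import Data.Nat.DivMod using (_%_)
open import Data.Fin using (Fin; toℕ)
open import Data.Fin.Subset using (Subset; _∈_; _∉_; _⊆_; _⊂_; _∩_; ∣_∣; ⊥)
open import Data.Product using (Σ; ∃; _×_; _,_)
open import Data.Sum using (_⊎_)
open import Relation.Nullary using (¬_)
open import Relation.Binary using (Decidable)
open import Relation.Binary.PropositionalEquality using (_≡_; _≢_)
open import Relation.Binary.Construct.Closure.ReflexiveTransitive using (Star)
open import Function.Definitions using (Injective)

record Graph (n : ℕ) : Set₁ where
  field
    Adj    : Fin n → Fin n → Set
    adj?   : Decidable Adj
    sym    : ∀ {u v} → Adj u v → Adj v u
    irrefl : ∀ {u} → ¬ Adj u u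

module _ {n : ℕ} (G : Graph n) where
  open Graph G

  -- u and v lie in the same component of G - X (walk avoiding X).
  data Conn (X : Subset n) : Fin n → Fin n → Set where
    here : ∀ {u} → u ∉ X → Conn X u u
    step : ∀ {u w v} → u ∉ X → Adj u w → Conn X w v → Conn X u v

  Connected : Set
  Connected = ∀ u v → Conn ⊥ u v

  CycAdj : (m : ℕ) → Fin (4 + m) → Fin (4 + m) → Set
  CycAdj m i j = toℕ j ≡ suc (toℕ i) % (4 + m) ⊎ toℕ i ≡ suc (toℕ j) % (4 + m)

  InducedCycle : (m : ℕ) → (Fin (4 + m) → Fin n) → Set
  InducedCycle m c =
    Injective _≡_ _≡_ c ×
    (∀ i j → (Adj (c i) (c j) → CycAdj m i j) × (CycAdj m i j → Adj (c i) (c j)))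

  Chordal : Set
  Chordal = ∀ m c → ¬ InducedCycle m c

  IsClique : Subset n → Set
  IsClique K = ∀ u v → u ∈ K → v ∈ K → u ≢ v → Adj u v

  IsMaxClique : Subset n → Set
  IsMaxClique K = IsClique K × (∀ K' → IsClique K' → K ⊆ K' → K' ⊆ K)

  IsSep : Subset n → Fin n → Fin n → Set
  IsSep X u v = u ∉ X × v ∉ X × ¬ Conn X u v

  IsMinSep : Subset n → Fin n → Fin n → Set
  IsMinSep X u v = IsSep X u v × (∀ Y → Y ⊂ X → ¬ IsSep Y u v)

  -- edges of the clique graph C(G)
  CEdge : Subset n → Subset n → Set
  CEdge K K' = IsMaxClique K × IsMaxClique K' × K ≢ K' ×
    (∀ u v → u ∈ K → u ∉ K' → v ∈ K' → v ∉ K → IsMinSep (K ∩ K') u v)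

  weight : Subset n → Subset n → ℕ
  weight K K' = ∣ K ∩ K' ∣

  -- edges of C(G) not of minimum weight (those kept when forming units)
  HeavyEdge : Subset n → Subset n → Set
  HeavyEdge K K' = CEdge K K' ×
    Σ (Subset n) λ L → Σ (Subset n) λ L' → CEdge L L' × weight L L' < weight K K'

  -- K and L are in the same unit (connected via non-minimum-weight edges)
  SameUnit : Subset n → Subset n → Set
  SameUnit = Star (λ K L → HeavyEdge K L ⊎ HeavyEdge L K)

  -- 𝒱(U) for the unit U containing the maximal clique R
  _∈𝒱_ : Fin n → Subset n → Set
  v ∈𝒱 R = Σ (Subset n) λ L → IsMaxClique L × SameUnit R L × v ∈ L

{-# OPTIONS --safe #-}
-- Write S = K ∩ K' and pick u ∈ K ∖ K', w ∈ K' ∖ K; S separates u from w.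
-- Since K and K' lie in different units, KK' has minimum weight, so every
-- edge inside a unit has a label strictly larger than S and hence shares a
-- vertex outside S. Through such a vertex, "every vertex of the clique is in S
-- or reachable from u in G − S" passes along unit edges, so it holds for every
-- clique of the unit of K; likewise with w for the unit of K'. A vertex of
-- 𝒱(U) ∩ 𝒱(U') outside S would then join u to w in G − S.
module Submission where

open import Defs
open import Data.Nat using (ℕ; _<_)
open import Data.Nat.Properties using (<⇒≱; ≮⇒≥; ≤-<-trans)
open import Data.Fin using (Fin)
open import Data.Fin.Properties using (any?) renaming (_≟_ to _≟ᶠ_)
open import Data.Fin.Subset using (Subset; _∈_; _∉_; _⊆_; _⊈_; _∩_; ∣_∣)
open import Data.Fin.Subset.Properties
  using (_∈?_; ⊆-antisym; p⊆q⇒∣p∣≤∣q∣; x∈p∩q⁺; x∈p∩q⁻; ∩-comm)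
open import Data.Product using (∃; _×_; _,_; proj₁; proj₂)
open import Data.Sum using (_⊎_; inj₁; inj₂; [_,_])
open import Data.Empty using (⊥-elim)
open import Function using (_∘_; id)
open import Relation.Nullary using (¬_; yes; no; ¬?)
open import Relation.Nullary.Decidable using (_×-dec_)
open import Relation.Binary.PropositionalEquality using (_≢_; refl; sym; subst)
open import Relation.Binary.Construct.Closure.ReflexiveTransitive
  using (ε; _◅_; _◅◅_; reverse)

⊈⇒∃∈∉ : ∀ {n} {p q : Subset n} → p ⊈ q → ∃ λ x → x ∈ p × x ∉ q
⊈⇒∃∈∉ {p = p} {q} p⊈q with any? (λ x → (x ∈? p) ×-dec ¬? (x ∈? q))
... | yes found = found
... | no none = ⊥-elim (p⊈q p⊆q)
  where
  p⊆q : p ⊆ q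
  p⊆q {x} x∈p with x ∈? q
  ... | yes x∈q = x∈q
  ... | no x∉q = ⊥-elim (none (x , x∈p , x∉q))

∣p∣<∣q∣⇒∃∈∉ : ∀ {n} {p q : Subset n} → ∣ p ∣ < ∣ q ∣ → ∃ λ x → x ∈ q × x ∉ p
∣p∣<∣q∣⇒∃∈∉ ∣p∣<∣q∣ = ⊈⇒∃∈∉ (<⇒≱ ∣p∣<∣q∣ ∘ p⊆q⇒∣p∣≤∣q∣)

SameUnit-sym : ∀ {n} (G : Graph n) {K L} → SameUnit G K L → SameUnit G L K
SameUnit-sym G = reverse [ inj₂ , inj₁ ]

module _ {n : ℕ} (G : Graph n) where
  open Graph G using (Adj)

  Conn-snoc : ∀ {X u w x} → Conn G X u w → Adj w x → x ∉ X → Conn G X u x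
  Conn-snoc (here u∉X)       w~x x∉X = step u∉X w~x (here x∉X)
  Conn-snoc (step u∉X u~y c) w~x x∉X = step u∉X u~y (Conn-snoc c w~x x∉X)

  Conn-sym : ∀ {X u v} → Conn G X u v → Conn G X v u
  Conn-sym (here u∉X)       = here u∉X
  Conn-sym (step u∉X u~w c) = Conn-snoc (Conn-sym c) (Graph.sym G u~w) u∉X

  Conn-trans : ∀ {X u w v} → Conn G X u w → Conn G X w v → Conn G X u v
  Conn-trans (here _)         c′ = c′
  Conn-trans (step u∉X u~y c) c′ = step u∉X u~y (Conn-trans c c′)

  maxClique-⊈ : ∀ {K K′} → IsMaxClique G K → IsClique G K′ → K ≢ K′ →
                ∃ λ x → x ∈ K × x ∉ K′
  maxClique-⊈ {K} {K′} (_ , maximal) K′-clique K≢K′ =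
    ⊈⇒∃∈∉ (λ K⊆K′ → K≢K′ (⊆-antisym K⊆K′ (maximal K′ K′-clique K⊆K′)))

  OnSide : Subset n → Fin n → Subset n → Set
  OnSide S u M = ∀ x → x ∈ M → x ∈ S ⊎ Conn G S u x

  OnSide-clique : ∀ {S u M N y} → IsClique G N → y ∈ M → y ∈ N → y ∉ S →
                  OnSide S u M → OnSide S u N
  OnSide-clique {S} {y = y} N-clique y∈M y∈N y∉S M-side x x∈N with x ∈? S
  ... | yes x∈S = inj₁ x∈S
  ... | no x∉S with M-side y y∈M
  ...   | inj₁ y∈S = ⊥-elim (y∉S y∈S)
  ...   | inj₂ u⇝y with x ≟ᶠ y
  ...     | yes refl = inj₂ u⇝y
  ...     | no x≢y = inj₂ (Conn-snoc u⇝y (N-clique y x y∈N x∈N (x≢y ∘ sym)) x∉S)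

  OnSide-own : ∀ {K K′ u} → IsClique G K → u ∈ K → u ∉ K′ → OnSide (K ∩ K′) u K
  OnSide-own {K} {K′} {u} K-clique u∈K u∉K′ x x∈K with x ∈? K′
  ... | yes x∈K′ = inj₁ (x∈p∩q⁺ (x∈K , x∈K′))
  ... | no x∉K′ with x ≟ᶠ u
  ...   | yes refl = inj₂ (here (u∉K′ ∘ proj₂ ∘ x∈p∩q⁻ K K′))
  ...   | no x≢u = inj₂ (step (u∉K′ ∘ proj₂ ∘ x∈p∩q⁻ K K′)
                              (K-clique u x u∈K x∈K (x≢u ∘ sym))
                              (here (x∉K′ ∘ proj₂ ∘ x∈p∩q⁻ K K′)))

  module UnitsAbove (S : Subset n) (heavy> : ∀ M N → HeavyEdge G M N → ∣ S ∣ < weight G M N) where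

    heavy-shares-outside : ∀ {M N} → HeavyEdge G M N → ∃ λ y → y ∈ M × y ∈ N × y ∉ S
    heavy-shares-outside {M} {N} h with y , y∈M∩N , y∉S ← ∣p∣<∣q∣⇒∃∈∉ (heavy> M N h) =
      y , proj₁ (x∈p∩q⁻ M N y∈M∩N) , proj₂ (x∈p∩q⁻ M N y∈M∩N) , y∉S

    OnSide-heavy : ∀ {u M N} → HeavyEdge G M N → OnSide S u M → OnSide S u N
    OnSide-heavy h@((_ , N-max , _) , _) with _ , y∈M , y∈N , y∉S ← heavy-shares-outside h =
      OnSide-clique (proj₁ N-max) y∈M y∈N y∉S

    OnSide-heavy⁻ : ∀ {u M N} → HeavyEdge G M N → OnSide S u N → OnSide S u M
    OnSide-heavy⁻ h@((M-max , _ , _) , _) with _ , y∈M , y∈N , y∉S ← heavy-shares-outside h =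
      OnSide-clique (proj₁ M-max) y∈N y∈M y∉S

    OnSide-unit : ∀ {u K L} → SameUnit G K L → OnSide S u K → OnSide S u L
    OnSide-unit ε                = id
    OnSide-unit (inj₁ h ◅ K~L) = OnSide-unit K~L ∘ OnSide-heavy h
    OnSide-unit (inj₂ h ◅ K~L) = OnSide-unit K~L ∘ OnSide-heavy⁻ h

    OnSide-𝒱 : ∀ {u K R v} → SameUnit G R K → OnSide S u K → _∈𝒱_ G v R → v ∈ S ⊎ Conn G S u v
    OnSide-𝒱 R~K K-side (L , _ , R~L , v∈L) =
      OnSide-unit (SameUnit-sym G R~K ◅◅ R~L) K-side _ v∈L

  light<heavy : ∀ {K K′} → CEdge G K K′ → ¬ HeavyEdge G K K′ →
                ∀ M N → HeavyEdge G M N → weight G K K′ < weight G M N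
  light<heavy e light M N (_ , L , L′ , e′ , L<MN) =
    ≤-<-trans (≮⇒≥ (λ L<KK′ → light (e , L , L′ , e′ , L<KK′))) L<MN

mainTheorem8 : ∀ {n} (G : Graph n) → Connected G → Chordal G →
    (Kstar : Subset n) → IsMaxClique G Kstar →
    -- units U, U' of C(G), given by representative maximal cliques R, R'
    ∀ R R' → IsMaxClique G R → IsMaxClique G R' → ¬ SameUnit G R R' →
    -- any edge K K' of C(G) crossing U and U' (so UU' is a layer edge)
    ∀ K K' → SameUnit G R K → SameUnit G R' K' → CEdge G K K' →
    -- its label K ∩ K' equals 𝒱(U) ∩ 𝒱(U')
    ∀ v → (v ∈ K ∩ K' → (_∈𝒱_ G v R × _∈𝒱_ G v R'))
        × ((_∈𝒱_ G v R × _∈𝒱_ G v R') → v ∈ K ∩ K')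
mainTheorem8 G _ _ _ _ R R′ _ _ R≁R′ K K′ R~K R′~K′ e@(K-max , K′-max , K≢K′ , sep) v =
  label⊆𝒱 , 𝒱⊆label
  where
  open UnitsAbove G (K ∩ K′) (light<heavy G e (λ h → R≁R′ (R~K ◅◅ inj₁ h ◅ SameUnit-sym G R′~K′)))
  label⊆𝒱 : v ∈ K ∩ K′ → _∈𝒱_ G v R × _∈𝒱_ G v R′
  label⊆𝒱 v∈K∩K′ = let v∈K , v∈K′ = x∈p∩q⁻ K K′ v∈K∩K′
                   in (K , K-max , R~K , v∈K) , (K′ , K′-max , R′~K′ , v∈K′)
  𝒱⊆label : _∈𝒱_ G v R × _∈𝒱_ G v R′ → v ∈ K ∩ K′
  𝒱⊆label (v∈𝒱R , v∈𝒱R′)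
    with u , u∈K , u∉K′ ← maxClique-⊈ G K-max (proj₁ K′-max) K≢K′
       | w , w∈K′ , w∉K ← maxClique-⊈ G K′-max (proj₁ K-max) (K≢K′ ∘ sym)
    with OnSide-𝒱 R~K (OnSide-own G (proj₁ K-max) u∈K u∉K′) v∈𝒱R
       | OnSide-𝒱 R′~K′ (subst (λ S → OnSide G S w K′) (∩-comm K′ K)
                              (OnSide-own G (proj₁ K′-max) w∈K′ w∉K)) v∈𝒱R′
  ... | inj₁ v∈S | _        = v∈S
  ... | inj₂ _   | inj₁ v∈S = v∈S
  ... | inj₂ u⇝v | inj₂ w⇝v = ⊥-elim (proj₂ (proj₂ (proj₁ (sep u w u∈K u∉K′ w∈K′ w∉K)))
                                             (Conn-trans G u⇝v (Conn-sym G w⇝v)))
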